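{- Fix distinct primes $p_0,p_1,q$ and put $s=p_0p_1q$. For each $l<\omega$ fix a permutation $\sigma_l$ of $\{0,1\}$, set $n_0=1$, and recursively define for $i\ge1$, writing $i=3l+m$ with $m\in\{0,1,2\}$: $n_{3l}=n_{3l-1}q$ (for $l\geq 1$), $n_{3l+1}=n_{3l}p_{\sigma_l(0)}$, $n_{3l+2}=n_{3l+1}p_{\sigma_l(1)}$. Let $v_\sigma:\mathbb{Z}\to\omega\cup\{\infty\}$ be the valuation $v_\sigma(x)=\max\{i: x\in n_i\mathbb{Z}\}$ and let $w:\mathbb{Z}\to\omega\cup\{\infty\}$ be the valuation $w(x)=\max\{i : x\in s^i\mathbb{Z}\}$. Then $w$ is definable in $(\mathbb{Z},+,v_\sigma)$.
   Context: $(\mathbb{Z},+,v_\sigma)$ denotes the two-sorted structure consisting of $(\mathbb{Z},+)$, the linear order $(\omega\cup\{\infty\},\le)$ and the map $v_\sigma$. Definability of $w$ means the relation $w(x)\le w(y)$ (equivalently, $w$ as a map to its value set) is definable in this structure. -}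

module Defs where

open import Data.Nat as ℕ using (ℕ; zero; suc; _^_)
open import Data.Nat.DivMod using (_/_; _%_)
open import Data.Nat.Primality using (Prime)
open import Data.Integer as ℤ using (ℤ; +_)
open import Data.Integer.Divisibility using (_∣_)
open import Data.Fin using (Fin; zero; suc)
open import Data.Fin.Permutation using (Permutation′; _⟨$⟩ʳ_)
open import Data.Vec.Functional using (Vector; _∷_)
open import Data.Product using (Σ; _×_; _,_; ∃)
open import Data.Sum using (_⊎_)
open import Data.Unit using (⊤)
open import Data.Empty using (⊥)
open import Relation.Binary.PropositionalEquality using (_≡_; _≢_)
open import Relation.Nullary using (¬_)
open import Function.Bundles using (_⇔_)

data ℕ∞ : Set where
  fin : ℕ → ℕ∞
  ∞   : ℕ∞

data _≤∞_ : ℕ∞ → ℕ∞ → Set where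
  fin≤fin : ∀ {m n} → m ℕ.≤ n → fin m ≤∞ fin n
  _≤∞∞    : ∀ r → r ≤∞ ∞

-- The valuation attached to a sequence d : ℕ → ℕ :
--   IsMaxIndex d x r  means  r = max { i : x ∈ d i ℤ }  (with r = ∞ when
--   the set is all of ω, i.e. unbounded, as happens for x = 0).

IsMaxIndex : (ℕ → ℕ) → ℤ → ℕ∞ → Set
IsMaxIndex d x (fin i) = ((+ d i) ∣ x) × (∀ j → (+ d j) ∣ x → j ℕ.≤ i)
IsMaxIndex d x ∞       = ∀ j → (+ d j) ∣ x

factor : (p : Fin 2 → ℕ) (q : ℕ) (σ : ℕ → Permutation′ 2) → ℕ → ℕ
factor p q σ i with i % 3
... | 0 = q
... | 1 = p (σ (i / 3) ⟨$⟩ʳ zero)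
... | _ = p (σ (i / 3) ⟨$⟩ʳ suc zero)

nSeq : (p : Fin 2 → ℕ) (q : ℕ) (σ : ℕ → Permutation′ 2) → ℕ → ℕ
nSeq p q σ zero    = 1
nSeq p q σ (suc i) = nSeq p q σ i ℕ.* factor p q σ (suc i)

-- First-order logic for the two-sorted language
--   sort Z : binary function symbol +
--   sort V : binary relation ≤
--   function symbol v : Z → V
-- (plus equality on each sort).

data TermZ (nz : ℕ) : Set where
  varZ : Fin nz → TermZ nz
  _⊕_  : TermZ nz → TermZ nz → TermZ nz

data TermV (nz nv : ℕ) : Set where
  varV : Fin nv → TermV nz nv
  val  : TermZ nz → TermV nz nv

data Formula : ℕ → ℕ → Set where
  ⊤ᶠ ⊥ᶠ : ∀ {nz nv} → Formula nz nv
  _≐Z_  : ∀ {nz nv} → TermZ nz → TermZ nz → Formula nz nv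
  _≐V_  : ∀ {nz nv} → TermV nz nv → TermV nz nv → Formula nz nv
  _≤V_  : ∀ {nz nv} → TermV nz nv → TermV nz nv → Formula nz nv
  ¬ᶠ_   : ∀ {nz nv} → Formula nz nv → Formula nz nv
  _∧ᶠ_ _∨ᶠ_ _⇒ᶠ_ : ∀ {nz nv} → Formula nz nv → Formula nz nv → Formula nz nv
  ∃Z ∀Z : ∀ {nz nv} → Formula (suc nz) nv → Formula nz nv
  ∃V ∀V : ∀ {nz nv} → Formula nz (suc nv) → Formula nz nv

module Semantics (v : ℤ → ℕ∞) where

  evalZ : ∀ {nz} → Vector ℤ nz → TermZ nz → ℤ
  evalZ ρ (varZ i) = ρ i
  evalZ ρ (t ⊕ u)  = evalZ ρ t ℤ.+ evalZ ρ u

  evalV : ∀ {nz nv} → Vector ℤ nz → Vector ℕ∞ nv → TermV nz nv → ℕ∞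
  evalV ρ η (varV i) = η i
  evalV ρ η (val t)  = v (evalZ ρ t)

  Sat : ∀ {nz nv} → Formula nz nv → Vector ℤ nz → Vector ℕ∞ nv → Set
  Sat ⊤ᶠ ρ η = ⊤
  Sat ⊥ᶠ ρ η = ⊥
  Sat (t ≐Z u) ρ η = evalZ ρ t ≡ evalZ ρ u
  Sat (t ≐V u) ρ η = evalV ρ η t ≡ evalV ρ η u
  Sat (t ≤V u) ρ η = evalV ρ η t ≤∞ evalV ρ η u
  Sat (¬ᶠ φ) ρ η = ¬ Sat φ ρ η
  Sat (φ ∧ᶠ ψ) ρ η = Sat φ ρ η × Sat ψ ρ η
  Sat (φ ∨ᶠ ψ) ρ η = Sat φ ρ η ⊎ Sat ψ ρ η
  Sat (φ ⇒ᶠ ψ) ρ η = Sat φ ρ η → Sat ψ ρ η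
  Sat (∃Z φ) ρ η = Σ ℤ λ a → Sat φ (a ∷ ρ) η
  Sat (∀Z φ) ρ η = (a : ℤ) → Sat φ (a ∷ ρ) η
  Sat (∃V φ) ρ η = Σ ℕ∞ λ r → Sat φ ρ (r ∷ η)
  Sat (∀V φ) ρ η = (r : ℕ∞) → Sat φ ρ (r ∷ η)

DefinableRel₂ : (v : ℤ → ℕ∞) → (ℤ → ℤ → Set) → Set
DefinableRel₂ v R =
  Σ ℕ λ kz → Σ ℕ λ kv →
  Σ (Vector ℤ kz) λ a → Σ (Vector ℕ∞ kv) λ b →
  Σ (Formula (suc (suc kz)) kv) λ φ →
  ∀ x y → Semantics.Sat v φ (x ∷ (y ∷ a)) b ⇔ R x y

-- Along the chain n₀ ∣ n₁ ∣ n₂ ∣ … each step multiplies by a single prime, so for a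
-- prime r the only values c = v_σ(z) with v_σ(r z) > v_σ(z) are those i whose next
-- factor n_{i+1}/n_i is r. For r = q these are exactly the i with 3 ∣ i + 1, so the
-- formula "∃ z. c = v_σ(z) ∧ v_σ(q z) > v_σ(z)" defines the set {3l + 2}. Since
-- n_{3l} = s^l, we have w(x) ≥ l iff v_σ(x) ≥ 3l, and therefore w(x) ≤ w(y) iff no
-- such c satisfies v_σ(y) ≤ c < v_σ(x).
module Submission where

open import Defs
open import Data.Nat using (ℕ; zero; suc; pred; _+_; _*_; _^_; _≤_; _<_; _≤′_; ≤′-refl; ≤′-step; z≤n; s≤s; NonZero)
open import Data.Nat.Properties
open import Data.Nat.DivMod using (_%_; _/_; [m+kn]%n≡m%n; m*n%n≡0; +-distrib-/-∣ʳ; m<n⇒m/n≡0; m*n/n≡m)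
open import Data.Nat.Divisibility using (divides; ∣-refl; ∣-trans; ∣-reflexive; m∣m*n; n∣m*n; *-monoʳ-∣; *-cancelˡ-∣; ∣1⇒≡1; m%n≡0⇔n∣m) renaming (_∣_ to _∣ℕ_)
open import Data.Nat.Primality using (Prime; euclidsLemma; prime⇒irreducible; prime⇒nonZero; ¬prime[1])
open import Data.Integer as ℤ using (ℤ; +_; ∣_∣)
import Data.Integer.Properties as ℤ
open import Data.Fin using (Fin; zero; suc)
open import Data.Fin.Permutation using (Permutation′; _⟨$⟩ʳ_)
open import Data.Vec.Functional using (Vector; _∷_; [])
open import Data.Product using (Σ; _×_; _,_; map₂)
open import Data.Sum using (inj₁; inj₂)
open import Function using (_∘_)
open import Function.Bundles using (_⇔_; mk⇔; module Equivalence; Injection)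
open import Function.Properties.Inverse using (↔⇒↣)
open import Function.Properties.Equivalence using (⇔-setoid)
open import Level using (0ℓ)
open import Relation.Nullary using (¬_; yes; no; contradiction)
open import Relation.Binary.PropositionalEquality using (_≡_; _≢_; refl; sym; trans; cong; cong₂; subst; subst₂; module ≡-Reasoning)

open Equivalence using (to; from)

≤∞-trans : ∀ {a b c} → a ≤∞ b → b ≤∞ c → a ≤∞ c
≤∞-trans _           (_ ≤∞∞)     = _ ≤∞∞
≤∞-trans (fin≤fin p) (fin≤fin q) = fin≤fin (≤-trans p q)

fin-suc≤∞⇒≰∞fin : ∀ {i r} → fin (suc i) ≤∞ r → ¬ (r ≤∞ fin i)
fin-suc≤∞⇒≰∞fin i<r r≤i with ≤∞-trans i<r r≤i
... | fin≤fin 1+i≤i = 1+n≰n 1+i≤i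

≰∞fin⇒fin-suc≤∞ : ∀ {i} r → ¬ (r ≤∞ fin i) → fin (suc i) ≤∞ r
≰∞fin⇒fin-suc≤∞         ∞       _   = _ ≤∞∞
≰∞fin⇒fin-suc≤∞ {i} (fin j) r≰i with i <? j
... | yes i<j = fin≤fin i<j
... | no  i≮j = contradiction (fin≤fin (≮⇒≥ i≮j)) r≰i

fin-lower-bounds⇒≤∞ : ∀ a b → (∀ i → fin i ≤∞ a → fin i ≤∞ b) → a ≤∞ b
fin-lower-bounds⇒≤∞ a       ∞       _ = a ≤∞∞
fin-lower-bounds⇒≤∞ (fin i) (fin j) h = h i (fin≤fin ≤-refl)
fin-lower-bounds⇒≤∞ ∞       (fin j) h = contradiction (fin≤fin ≤-refl) (fin-suc≤∞⇒≰∞fin (h (suc j) (_ ≤∞∞)))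

SeparatedByMultipleOf : ℕ → ℕ∞ → ℕ∞ → Set
SeparatedByMultipleOf k b a = Σ ℕ λ i → k ∣ℕ suc i × b ≤∞ fin i × ¬ (a ≤∞ fin i)

multiples-below-monotone⇔¬separated : ∀ k a b →
  (∀ l → fin (l * k) ≤∞ a → fin (l * k) ≤∞ b) ⇔ (¬ SeparatedByMultipleOf k b a)
multiples-below-monotone⇔¬separated k a b = mk⇔ no-separation monotone
  where
  no-separation : (∀ l → fin (l * k) ≤∞ a → fin (l * k) ≤∞ b) → ¬ SeparatedByMultipleOf k b a
  no-separation h (i , divides l 1+i≡lk , b≤i , a≰i) =
    fin-suc≤∞⇒≰∞fin (subst (λ m → fin m ≤∞ b) (sym 1+i≡lk) lk≤b) b≤i
    where
    lk≤b : fin (l * k) ≤∞ b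
    lk≤b = h l (subst (λ m → fin m ≤∞ a) 1+i≡lk (≰∞fin⇒fin-suc≤∞ a a≰i))

  separation-below : ∀ {m j} → m < j → fin j ≤∞ a → Σ ℕ λ i → j ≡ suc i × m ≤ i × ¬ (a ≤∞ fin i)
  separation-below {j = suc i} (s≤s m≤i) j≤a = i , refl , m≤i , fin-suc≤∞⇒≰∞fin j≤a

  monotone : ∀ {c} → ¬ SeparatedByMultipleOf k c a → ∀ l → fin (l * k) ≤∞ a → fin (l * k) ≤∞ c
  monotone {∞}     _    _ _    = _ ≤∞∞
  monotone {fin m} ¬sep l lk≤a with l * k ≤? m
  ... | yes lk≤m = fin≤fin lk≤m
  ... | no  lk≰m with separation-below (≰⇒> lk≰m) lk≤a
  ...   | i , lk≡1+i , m≤i , a≰i = contradiction (i , divides l (sym lk≡1+i) , fin≤fin m≤i , a≰i) ¬sep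

module DivisibilityChain (d : ℕ → ℕ) (d-step : ∀ i → d i ∣ℕ d (suc i)) where

  d-mono : ∀ {i j} → i ≤ j → d i ∣ℕ d j
  d-mono = go ∘ ≤⇒≤′
    where
    go : ∀ {i j} → i ≤′ j → d i ∣ℕ d j
    go ≤′-refl       = ∣-refl
    go (≤′-step i≤j) = ∣-trans (go i≤j) (d-step _)

  ∣⇒fin≤∞ : ∀ {x r} → IsMaxIndex d x r → ∀ i → d i ∣ℕ ∣ x ∣ → fin i ≤∞ r
  ∣⇒fin≤∞ {r = fin m} (_ , maximal) i dᵢ∣x = fin≤fin (maximal i dᵢ∣x)
  ∣⇒fin≤∞ {r = ∞}     _             i _    = _ ≤∞∞

  fin≤∞⇒∣ : ∀ {x r} → IsMaxIndex d x r → ∀ i → fin i ≤∞ r → d i ∣ℕ ∣ x ∣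
  fin≤∞⇒∣ {r = fin m} (dₘ∣x , _) i (fin≤fin i≤m) = ∣-trans (d-mono i≤m) dₘ∣x
  fin≤∞⇒∣ {r = ∞}     all-d∣x    i _             = all-d∣x i

N*F∣q*k⇒F≡q : ∀ {N F q k} .{{_ : NonZero N}} → Prime F → Prime q →
              N ∣ℕ k → ¬ (N * F ∣ℕ k) → N * F ∣ℕ q * k → F ≡ q
N*F∣q*k⇒F≡q {N} {F} {q} F-prime q-prime (divides t refl) N*F∤k N*F∣q*k
  with euclidsLemma q t F-prime (*-cancelˡ-∣ N (subst (N * F ∣ℕ_) q*[t*N]≡N*[q*t] N*F∣q*k))
  where
  q*[t*N]≡N*[q*t] : q * (t * N) ≡ N * (q * t)
  q*[t*N]≡N*[q*t] = trans (sym (*-assoc q t N)) (*-comm (q * t) N)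
... | inj₂ F∣t = contradiction (subst (N * F ∣ℕ_) (*-comm N t) (*-monoʳ-∣ N F∣t)) N*F∤k
... | inj₁ F∣q with prime⇒irreducible q-prime F∣q
...   | inj₁ F≡1 = contradiction (subst Prime F≡1 F-prime) ¬prime[1]
...   | inj₂ F≡q = F≡q

IsJump : (ℤ → ℕ∞) → ℕ → ℕ∞ → Set
IsJump v m c = Σ ℤ λ z → v z ≡ c × ¬ (v (+ m ℤ.* z) ≤∞ v z)

module PrimeChain (n f : ℕ → ℕ) (n₀-nonZero : NonZero (n 0))
  (n-suc : ∀ i → n (suc i) ≡ n i * f i) (f-prime : ∀ i → Prime (f i))
  (v : ℤ → ℕ∞) (v-max : ∀ x → IsMaxIndex n x (v x)) where

  n-nonZero : ∀ i → NonZero (n i)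
  n-nonZero zero    = n₀-nonZero
  n-nonZero (suc i) = subst NonZero (sym (n-suc i))
    (m*n≢0 (n i) (f i) {{n-nonZero i}} {{prime⇒nonZero (f-prime i)}})

  n-step : ∀ i → n i ∣ℕ n (suc i)
  n-step i = subst (n i ∣ℕ_) (sym (n-suc i)) (m∣m*n (f i))

  open DivisibilityChain n n-step public

  n[1+i]∤n[i] : ∀ i → ¬ (n (suc i) ∣ℕ n i)
  n[1+i]∤n[i] i n[1+i]∣n[i] = ¬prime[1] (subst Prime (∣1⇒≡1 fᵢ∣1) (f-prime i))
    where
    fᵢ∣1 : f i ∣ℕ 1
    fᵢ∣1 = *-cancelˡ-∣ (n i) {{n-nonZero i}}
      (subst₂ _∣ℕ_ (n-suc i) (sym (*-identityʳ (n i))) n[1+i]∣n[i])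

  v-n : ∀ i → v (+ n i) ≡ fin i
  v-n i = maxIndex≡ (v (+ n i)) (v-max (+ n i))
    where
    maxIndex≡ : ∀ r → IsMaxIndex n (+ n i) r → r ≡ fin i
    maxIndex≡ ∞       all-n∣nᵢ           = contradiction (all-n∣nᵢ (suc i)) (n[1+i]∤n[i] i)
    maxIndex≡ (fin j) (nⱼ∣nᵢ , maximal) = cong fin (≤-antisym
      (≮⇒≥ λ i<j → n[1+i]∤n[i] i (∣-trans (d-mono i<j) nⱼ∣nᵢ))
      (maximal i ∣-refl))

  jump⇒step≡ : ∀ {q} → Prime q → ∀ z r → IsMaxIndex n z r → ¬ (v (+ q ℤ.* z) ≤∞ r) →
               Σ ℕ λ i → r ≡ fin i × f i ≡ q
  jump⇒step≡ _ z ∞ _ qz≰∞ = contradiction (_ ≤∞∞) qz≰∞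
  jump⇒step≡ {q} q-prime z (fin i) (nᵢ∣z , maximal) qz≰i =
    i , refl , N*F∣q*k⇒F≡q {{n-nonZero i}} (f-prime i) q-prime nᵢ∣z nᵢfᵢ∤z nᵢfᵢ∣qz
    where
    nᵢfᵢ∤z : ¬ (n i * f i ∣ℕ ∣ z ∣)
    nᵢfᵢ∤z h = 1+n≰n (maximal (suc i) (subst (_∣ℕ ∣ z ∣) (sym (n-suc i)) h))
    nᵢfᵢ∣qz : n i * f i ∣ℕ q * ∣ z ∣
    nᵢfᵢ∣qz = subst₂ _∣ℕ_ (n-suc i) (ℤ.abs-* (+ q) z)
      (fin≤∞⇒∣ (v-max _) (suc i) (≰∞fin⇒fin-suc≤∞ _ qz≰i))

  step≡⇒jump : ∀ {q} i → f i ≡ q → IsJump v q (fin i)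
  step≡⇒jump {q} i fᵢ≡q = + n i , v-n i , λ qnᵢ≤nᵢ →
    fin-suc≤∞⇒≰∞fin (∣⇒fin≤∞ (v-max _) (suc i) nᵢ₊₁∣qnᵢ) (subst (v (+ q ℤ.* + n i) ≤∞_) (v-n i) qnᵢ≤nᵢ)
    where
    open ≡-Reasoning
    nᵢ₊₁∣qnᵢ : n (suc i) ∣ℕ ∣ + q ℤ.* + n i ∣
    nᵢ₊₁∣qnᵢ = ∣-reflexive (begin
      n (suc i)            ≡⟨ n-suc i ⟩
      n i * f i            ≡⟨ cong (n i *_) fᵢ≡q ⟩
      n i * q              ≡⟨ *-comm (n i) q ⟩
      q * n i              ≡⟨ ℤ.abs-* (+ q) (+ n i) ⟨
      ∣ + q ℤ.* + n i ∣    ∎)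

  IsJump⇔step≡ : ∀ {q} → Prime q → ∀ c → IsJump v q c ⇔ (Σ ℕ λ i → c ≡ fin i × f i ≡ q)
  IsJump⇔step≡ q-prime c = mk⇔
    (λ { (z , refl , qz≰z) → jump⇒step≡ q-prime z (v z) (v-max z) qz≰z })
    (λ { (i , refl , fᵢ≡q) → step≡⇒jump i fᵢ≡q })

∏-permute₂ : (p : Fin 2 → ℕ) (π : Permutation′ 2) →
             p (π ⟨$⟩ʳ zero) * p (π ⟨$⟩ʳ suc zero) ≡ p zero * p (suc zero)
∏-permute₂ p π with π ⟨$⟩ʳ zero in π0 | π ⟨$⟩ʳ suc zero in π1
... | zero     | suc zero = refl
... | suc zero | zero     = *-comm (p (suc zero)) (p zero)
... | zero     | zero     = contradiction (Injection.injective (↔⇒↣ π) (trans π0 (sym π1))) λ ()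
... | suc zero | suc zero = contradiction (Injection.injective (↔⇒↣ π) (trans π0 (sym π1))) λ ()

[m+l*3]/3≡l : ∀ m l → m < 3 → (m + l * 3) / 3 ≡ l
[m+l*3]/3≡l m l m<3 = begin
  (m + l * 3) / 3      ≡⟨ +-distrib-/-∣ʳ m (divides l refl) ⟩
  m / 3 + l * 3 / 3    ≡⟨ cong₂ _+_ (m<n⇒m/n≡0 m<3) (m*n/n≡m l 3) ⟩
  l                    ∎
  where open ≡-Reasoning

module _ (p : Fin 2 → ℕ) (q : ℕ) (σ : ℕ → Permutation′ 2) where

  factor-prime : (∀ j → Prime (p j)) → Prime q → ∀ i → Prime (factor p q σ i)
  factor-prime p-prime q-prime i with i % 3
  ... | 0           = q-prime
  ... | 1           = p-prime _
  ... | suc (suc _) = p-prime _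

  factor≡q⇔3∣ : (∀ j → p j ≢ q) → ∀ i → factor p q σ i ≡ q ⇔ 3 ∣ℕ i
  factor≡q⇔3∣ p≢q i = mk⇔ (to (m%n≡0⇔n∣m i 3) ∘ factor≡q⇒%3≡0) (%3≡0⇒factor≡q ∘ from (m%n≡0⇔n∣m i 3))
    where
    factor≡q⇒%3≡0 : factor p q σ i ≡ q → i % 3 ≡ 0
    factor≡q⇒%3≡0 with i % 3
    ... | 0           = λ _ → refl
    ... | 1           = λ pⱼ≡q → contradiction pⱼ≡q (p≢q _)
    ... | suc (suc _) = λ pⱼ≡q → contradiction pⱼ≡q (p≢q _)

    %3≡0⇒factor≡q : i % 3 ≡ 0 → factor p q σ i ≡ q
    %3≡0⇒factor≡q with i % 3
    ... | 0     = λ _ → refl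
    ... | suc _ = λ ()

  factor-3l+1 : ∀ l → factor p q σ (1 + l * 3) ≡ p (σ l ⟨$⟩ʳ zero)
  factor-3l+1 l with (1 + l * 3) % 3 | [m+kn]%n≡m%n 1 l 3
  ... | .1 | refl = cong (λ k → p (σ k ⟨$⟩ʳ zero)) ([m+l*3]/3≡l 1 l (s≤s (s≤s z≤n)))

  factor-3l+2 : ∀ l → factor p q σ (2 + l * 3) ≡ p (σ l ⟨$⟩ʳ suc zero)
  factor-3l+2 l with (2 + l * 3) % 3 | [m+kn]%n≡m%n 2 l 3
  ... | .2 | refl = cong (λ k → p (σ k ⟨$⟩ʳ suc zero)) ([m+l*3]/3≡l 2 l (s≤s (s≤s (s≤s z≤n))))

  factor-3l+3 : ∀ l → factor p q σ (3 + l * 3) ≡ q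
  factor-3l+3 l with (3 + l * 3) % 3 | m*n%n≡0 (suc l) 3
  ... | .0 | refl = refl

  nSeq-3l : ∀ l → nSeq p q σ (l * 3) ≡ (p zero * p (suc zero) * q) ^ l
  nSeq-3l zero    = refl
  nSeq-3l (suc l) = begin
    N * factor p q σ (1 + l * 3) * factor p q σ (2 + l * 3) * factor p q σ (3 + l * 3)
      ≡⟨ cong₂ (λ a b → N * a * b * factor p q σ (3 + l * 3)) (factor-3l+1 l) (factor-3l+2 l) ⟩
    N * p (σ l ⟨$⟩ʳ zero) * p (σ l ⟨$⟩ʳ suc zero) * factor p q σ (3 + l * 3)
      ≡⟨ cong₂ _*_ (*-assoc N _ _) (factor-3l+3 l) ⟩
    N * (p (σ l ⟨$⟩ʳ zero) * p (σ l ⟨$⟩ʳ suc zero)) * q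
      ≡⟨ cong (λ a → N * a * q) (∏-permute₂ p (σ l)) ⟩
    N * (p zero * p (suc zero)) * q
      ≡⟨ trans (*-assoc N _ q) (*-comm N s) ⟩
    s * N
      ≡⟨ cong (s *_) (nSeq-3l l) ⟩
    s * s ^ l
      ∎
    where
    open ≡-Reasoning
    N = nSeq p q σ (l * 3)
    s = p zero * p (suc zero) * q

[1+_]·_ : ∀ {nz} → ℕ → TermZ nz → TermZ nz
[1+ zero  ]· t = t
[1+ suc k ]· t = t ⊕ ([1+ k ]· t)

IsJumpᶠ : ∀ {nz} → ℕ → Formula nz 1
IsJumpᶠ k = ∃Z ((val (varZ zero) ≐V varV zero) ∧ᶠ (¬ᶠ (val ([1+ k ]· varZ zero) ≤V val (varZ zero))))

noJumpBetweenᶠ : ℕ → Formula 2 0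
noJumpBetweenᶠ k = ¬ᶠ ∃V (IsJumpᶠ k ∧ᶠ ((val (varZ (suc zero)) ≤V varV zero) ∧ᶠ (¬ᶠ (val (varZ zero) ≤V varV zero))))

module _ (v : ℤ → ℕ∞) where
  open Semantics v

  evalZ-[1+]· : ∀ {nz} (ρ : Vector ℤ nz) k t → evalZ ρ ([1+ k ]· t) ≡ + suc k ℤ.* evalZ ρ t
  evalZ-[1+]· ρ zero    t = sym (ℤ.*-identityˡ (evalZ ρ t))
  evalZ-[1+]· ρ (suc k) t = trans (cong (λ u → evalZ ρ t ℤ.+ u) (evalZ-[1+]· ρ k t)) (sym (ℤ.suc-* (+ suc k) (evalZ ρ t)))

  sat-IsJumpᶠ⇔ : ∀ {nz} k (ρ : Vector ℤ nz) (η : Vector ℕ∞ 1) → Sat (IsJumpᶠ k) ρ η ⇔ IsJump v (suc k) (η zero)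
  sat-IsJumpᶠ⇔ k ρ η = mk⇔
    (λ { (z , vz≡c , mz≰z) → z , vz≡c , mz≰z ∘ subst (λ t → v t ≤∞ v z) (sym (eval-mz z)) })
    (λ { (z , vz≡c , mz≰z) → z , vz≡c , mz≰z ∘ subst (λ t → v t ≤∞ v z) (eval-mz z) })
    where
    eval-mz : ∀ z → evalZ (z ∷ ρ) ([1+ k ]· varZ zero) ≡ + suc k ℤ.* z
    eval-mz z = evalZ-[1+]· (z ∷ ρ) k (varZ zero)

  sat-noJumpBetweenᶠ⇔ : ∀ k m → (∀ c → IsJump v (suc k) c ⇔ (Σ ℕ λ i → c ≡ fin i × m ∣ℕ suc i)) →
                        ∀ x y → Sat (noJumpBetweenᶠ k) (x ∷ y ∷ []) [] ⇔ (¬ SeparatedByMultipleOf m (v y) (v x))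
  sat-noJumpBetweenᶠ⇔ k m jumps x y = mk⇔ ¬separated ¬jump-between
    where
    ρ : Vector ℤ 2
    ρ = x ∷ y ∷ []

    ¬separated : Sat (noJumpBetweenᶠ k) ρ [] → ¬ SeparatedByMultipleOf m (v y) (v x)
    ¬separated ¬jump (i , m∣1+i , vy≤i , vx≰i) =
      ¬jump (fin i , from (sat-IsJumpᶠ⇔ k ρ (fin i ∷ [])) (from (jumps (fin i)) (i , refl , m∣1+i)) , vy≤i , vx≰i)

    ¬jump-between : ¬ SeparatedByMultipleOf m (v y) (v x) → Sat (noJumpBetweenᶠ k) ρ []
    ¬jump-between ¬sep (c , jump , vy≤c , vx≰c) with to (jumps c) (to (sat-IsJumpᶠ⇔ k ρ (c ∷ [])) jump)
    ... | i , refl , m∣1+i = ¬sep (i , m∣1+i , vy≤c , vx≰c)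

module Proposition5p2 (p : Fin 2 → ℕ) (q : ℕ)
  (p-prime : ∀ j → Prime (p j)) (q-prime : Prime q) (p≢q : ∀ j → p j ≢ q)
  (σ : ℕ → Permutation′ 2)
  (v : ℤ → ℕ∞) (v-max : ∀ x → IsMaxIndex (nSeq p q σ) x (v x))
  (w : ℤ → ℕ∞) (w-max : ∀ x → IsMaxIndex (λ i → (p zero * p (suc zero) * q) ^ i) x (w x)) where

  s : ℕ
  s = p zero * p (suc zero) * q

  module V = PrimeChain (nSeq p q σ) (λ i → factor p q σ (suc i)) _ (λ _ → refl)
                        (factor-prime p q σ p-prime q-prime ∘ suc) v v-max
  module W = DivisibilityChain (s ^_) (λ i → n∣m*n s)

  jumps : ∀ c → IsJump v q c ⇔ (Σ ℕ λ i → c ≡ fin i × 3 ∣ℕ suc i)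
  jumps c = mk⇔ (map₂ (map₂ (to (factor≡q⇔3∣ p q σ p≢q _))) ∘ to (V.IsJump⇔step≡ q-prime c))
                (from (V.IsJump⇔step≡ q-prime c) ∘ map₂ (map₂ (from (factor≡q⇔3∣ p q σ p≢q _))))

  v≥3l⇔w≥l : ∀ x l → fin (l * 3) ≤∞ v x ⇔ fin l ≤∞ w x
  v≥3l⇔w≥l x l = mk⇔
    (W.∣⇒fin≤∞ (w-max x) l ∘ subst (_∣ℕ ∣ x ∣) (nSeq-3l p q σ l) ∘ V.fin≤∞⇒∣ (v-max x) (l * 3))
    (V.∣⇒fin≤∞ (v-max x) (l * 3) ∘ subst (_∣ℕ ∣ x ∣) (sym (nSeq-3l p q σ l)) ∘ W.fin≤∞⇒∣ (w-max x) l)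

  w≤w⇔multiples-below-monotone : ∀ x y →
    w x ≤∞ w y ⇔ (∀ l → fin (l * 3) ≤∞ v x → fin (l * 3) ≤∞ v y)
  w≤w⇔multiples-below-monotone x y = mk⇔
    (λ wx≤wy l → from (v≥3l⇔w≥l y l) ∘ (λ l≤wx → ≤∞-trans l≤wx wx≤wy) ∘ to (v≥3l⇔w≥l x l))
    (λ h → fin-lower-bounds⇒≤∞ (w x) (w y) λ l → to (v≥3l⇔w≥l y l) ∘ h l ∘ from (v≥3l⇔w≥l x l))

proposition5p2 : (p : Fin 2 → ℕ) (q : ℕ) →
    Prime (p zero) → Prime (p (suc zero)) → Prime q →
    p zero ≢ p (suc zero) → p zero ≢ q → p (suc zero) ≢ q →
    (σ : ℕ → Permutation′ 2) →
    (vσ : ℤ → ℕ∞) → (∀ x → IsMaxIndex (nSeq p q σ) x (vσ x)) →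
    (w : ℤ → ℕ∞) →
    (∀ x → IsMaxIndex (λ i → (p zero * p (suc zero) * q) ^ i) x (w x)) →
    DefinableRel₂ vσ (λ x y → w x ≤∞ w y)
proposition5p2 p q p₀-prime p₁-prime q-prime _ p₀≢q p₁≢q σ v v-max w w-max =
  0 , 0 , [] , [] , noJumpBetweenᶠ (pred q) , λ x y → begin
    Sat (noJumpBetweenᶠ (pred q)) (x ∷ y ∷ []) []      ≈⟨ sat-noJumpBetweenᶠ⇔ v (pred q) 3 jumps′ x y ⟩
    ¬ SeparatedByMultipleOf 3 (v y) (v x)               ≈⟨ multiples-below-monotone⇔¬separated 3 (v x) (v y) ⟨
    (∀ l → fin (l * 3) ≤∞ v x → fin (l * 3) ≤∞ v y)     ≈⟨ P.w≤w⇔multiples-below-monotone x y ⟨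
    w x ≤∞ w y                                          ∎
  where
  open Semantics v using (Sat)
  open import Relation.Binary.Reasoning.Setoid (⇔-setoid 0ℓ)

  p-prime : ∀ j → Prime (p j)
  p-prime zero       = p₀-prime
  p-prime (suc zero) = p₁-prime

  p≢q : ∀ j → p j ≢ q
  p≢q zero       = p₀≢q
  p≢q (suc zero) = p₁≢q

  module P = Proposition5p2 p q p-prime q-prime p≢q σ v v-max w w-max

  jumps′ : ∀ c → IsJump v (suc (pred q)) c ⇔ (Σ ℕ λ i → c ≡ fin i × 3 ∣ℕ suc i)
  jumps′ c = subst (λ m → IsJump v m c ⇔ _) (sym (suc-pred q {{prime⇒nonZero q-prime}})) (P.jumps c)
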